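{- Let $D$ be a digraph on vertex set $\{1,\dots,n\}$. For every $q\ge 3$, $\operatorname{ima}[D,q]=\operatorname{ima}(D,q)=\alpha_1(D)$. For $q=2$, $\operatorname{ima}(D,2)=\alpha_1(D)$.
   Context: A digraph $D=(V,E)$ has $V=\{1,\dots,n\}$ and $E\subseteq V^2$ (loops allowed). Two arcs $(u,v),(u',v')$ are independent if $u\ne u'$ and $v\ne v'$; $\alpha_1(D)$ is the maximum number of pairwise independent arcs of $D$. Let $[q]=\{0,\dots,q-1\}$. For $f=(f_1,\dots,f_n):[q]^n\to[q]^n$, the interaction graph $\mathrm{IG}(f)$ is the digraph on $V$ with $(u,v)$ an arc iff $f_v$ depends essentially on $x_u$. $F[D,q]=\{f:[q]^n\to[q]^n:\mathrm{IG}(f)=D\}$, $F(D,q)=\{f:[q]^n\to[q]^n:\mathrm{IG}(f)\subseteq D\}$. $\operatorname{ima}(f)=\log_q|\mathrm{Im}(f)|$, $\operatorname{ima}[D,q]=\max\{\operatorname{ima}(f):f\in F[D,q]\}$ and $\operatorname{ima}(D,q)=\max\{\operatorname{ima}(f):f\in F(D,q)\}$. -}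

module Defs where

open import Data.Nat using (ℕ; zero; suc; _≤_; _^_)
open import Data.Fin using (Fin)
open import Data.Fin.Properties using () renaming (_≟_ to _≟ᶠ_)
open import Data.Bool using (Bool; true)
open import Data.Vec using (Vec; []; _∷_; lookup; _[_]≔_)
open import Data.Vec.Properties using (≡-dec)
open import Data.List using (List; []; _∷_; map; concatMap; allFin; length; deduplicate)
open import Data.Product using (Σ; ∃; _×_; _,_)
open import Function.Definitions using (Injective)
open import Function.Bundles using (_⇔_)
open import Relation.Binary.PropositionalEquality using (_≡_; _≢_)

-- A digraph on vertex set Fin n (= {1,…,n}); D u v ≡ true iff (u,v) is an arc.
-- Loops are allowed.
Digraph : ℕ → Set
Digraph n = Fin n → Fin n → Bool

Arc : ∀ {n} → Digraph n → Fin n → Fin n → Set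
Arc D u v = D u v ≡ true

IndepArcs : ∀ {n} → Digraph n → ℕ → Set
IndepArcs {n} D k =
  Σ (Fin k → Fin n) λ s → Σ (Fin k → Fin n) λ t →
    (∀ i → Arc D (s i) (t i)) × Injective _≡_ _≡_ s × Injective _≡_ _≡_ t

IsAlpha1 : ∀ {n} → Digraph n → ℕ → Set
IsAlpha1 D a = IndepArcs D a × (∀ k → IndepArcs D k → k ≤ a)

Config : ℕ → ℕ → Set
Config q n = Vec (Fin q) n

Map : ℕ → ℕ → Set
Map q n = Config q n → Config q n

allConfigs : ∀ q n → List (Config q n)
allConfigs q zero = [] ∷ []
allConfigs q (suc n) = concatMap (λ a → map (a ∷_) (allConfigs q n)) (allFin q)

imSize : ∀ {q n} → Map q n → ℕ
imSize {q} {n} f = length (deduplicate (≡-dec _≟ᶠ_) (map f (allConfigs q n)))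

DependsOn : ∀ {q n} → Map q n → Fin n → Fin n → Set
DependsOn {q} {n} f u v =
  Σ (Config q n) λ x → Σ (Fin q) λ a → lookup (f x) v ≢ lookup (f (x [ u ]≔ a)) v

IGEq : ∀ {q n} → Map q n → Digraph n → Set
IGEq f D = ∀ u v → Arc D u v ⇔ DependsOn f u v

IGSub : ∀ {q n} → Map q n → Digraph n → Set
IGSub f D = ∀ u v → DependsOn f u v → Arc D u v

-- max { ima(f) : f ∈ F, P f } = a, i.e. max |Im f| = q^a
-- (log_q is strictly increasing, so this is ima = a).
MaxIma : ∀ {n} → (q : ℕ) → (Map q n → Set) → ℕ → Set
MaxIma {n} q P a =
  (Σ (Map q n) λ f → P f × imSize f ≡ q ^ a) × (∀ (f : Map q n) → P f → imSize f ≤ q ^ a)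

-- ima[D,q] = a
ImaEq : ∀ {n} → Digraph n → ℕ → ℕ → Set
ImaEq D q a = MaxIma q (λ f → IGEq f D) a

-- ima(D,q) = a
ImaSub : ∀ {n} → Digraph n → ℕ → ℕ → Set
ImaSub D q a = MaxIma q (λ f → IGSub f D) a

-- By Kőnig's theorem (derived from Hall's) the bipartite graph whose edges are the
-- arcs of D has a vertex cover (A, B) together with ∣A∣ + ∣B∣ independent arcs, so ∣A∣ + ∣B∣ ≤ α₁;
-- every arc has its tail in A or its head in B. If IG(f) ⊆ D, a coordinate of f outside B depends
-- only on x restricted to A, so f x is determined by x on A together with f x on B, and
-- ∣Im f∣ ≤ q ^ α₁.
--
-- Given α₁ independent arcs (s i, t i), let f copy x (s i) to t i, exchanging 0 and 1
-- when another in-neighbour of t i carries a value ≥ 2, and let every other coordinate of f indicate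
-- whether some in-neighbour carries a value ≥ 2. Exchanging 0 and 1 preserves being ≥ 2, so the
-- exchanges can be undone on configurations supported on the tails: ∣Im f∣ ≥ q ^ α₁. Raising one
-- in-neighbour of v from 0 to 2 changes f v, so IG(f) = D as soon as q ≥ 3.

module Submission where

open import Defs
open import Data.Nat using (ℕ; _≤_)
open import Data.Product using (_×_)

open import Level using (0ℓ)
open import Data.Bool using (Bool; true; false; if_then_else_)
open import Data.Bool.Properties using () renaming (_≟_ to _≟ᵇ_)
open import Data.Nat using (zero; suc; _+_; _*_; _^_; _<_; z≤n; s≤s; _≤?_; _<?_)
open import Data.Nat.Properties hiding (suc-injective)
open import Data.Nat.Induction using (<-wellFounded)
open import Data.Fin using (Fin; zero; suc; splitAt; join)
open import Data.Fin.Properties using (any?; join-splitAt; suc-injective) renaming (_≟_ to _≟ᶠ_)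
open import Data.Fin.Subset
open import Data.Fin.Subset.Properties
open import Data.Vec
  using (Vec; []; _∷_; here; there; lookup; tabulate; replicate; _[_]≔_; _++_; take; drop)
open import Data.Vec.Properties
  using ( lookup∘tabulate; tabulate∘lookup; tabulate-cong; lookup⇒[]=; []=⇒lookup
        ; lookup∘update; lookup∘update′; lookup-replicate; ++-injectiveˡ; ++-injectiveʳ; take++drop≡id
        ; ≡-dec; ∷-injective)
import Data.Vec.Functional as Vector
open import Data.List
  using (List; []; _∷_; map; concatMap; cartesianProductWith; allFin; length; deduplicate)
  renaming (_++_ to _++ˡ_)
open import Data.List.Properties using (length-map; length-++; length-tabulate)
open import Data.List.Membership.Propositional using () renaming (_∈_ to _∈ˡ_)
open import Data.List.Membership.Propositional.Properties
  using ( ∈-∃++; ∈-++⁻; ∈-++⁺ˡ; ∈-++⁺ʳ; ∈-map⁺; ∈-map⁻; ∈-allFin; ∈-cartesianProductWith⁺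
        ; ∈-deduplicate⁺; ∈-deduplicate⁻)
open import Data.List.Relation.Unary.Any using () renaming (here to hereˡ; there to thereˡ)
import Data.List.Relation.Unary.All as All
open import Data.List.Relation.Unary.Unique.Propositional using (Unique; []; _∷_)
open import Data.List.Relation.Unary.Unique.Propositional.Properties
  using (allFin⁺; cartesianProductWith⁺; map⁺)
open import Data.List.Relation.Unary.Unique.DecPropositional.Properties using (deduplicate-!)
open import Data.Product using (∃; ∃₂; _,_; proj₁; proj₂)
open import Data.Sum using (_⊎_; inj₁; inj₂; [_,_]′)
open import Function using (_∘_; _on_; flip; id)
open import Function.Bundles using (mk⇔; Equivalence)
open import Function.Definitions using (Injective)
import Induction.WellFounded as WF
open import Relation.Binary.Construct.On as On using ()
open import Relation.Binary.Definitions using (DecidableEquality)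
open import Relation.Binary.PropositionalEquality
open import Relation.Nullary using (Dec; yes; no; does; ¬_; contradiction)
open import Relation.Nullary.Decidable using (dec-true; dec-false; does-⇔; _×-dec_; ¬?)

variable
  m n : ℕ

does-true : {A : Set} (a? : Dec A) → does a? ≡ true → A
does-true (yes a) _ = a

⟦_⟧ : {P : Fin n → Set} → (∀ x → Dec (P x)) → Subset n
⟦ P? ⟧ = tabulate (does ∘ P?)

module _ {P : Fin n → Set} (P? : ∀ x → Dec (P x)) {x : Fin n} where

  ∈⟦⟧⁺ : P x → x ∈ ⟦ P? ⟧
  ∈⟦⟧⁺ px = lookup⇒[]= x _ (trans (lookup∘tabulate (does ∘ P?) x) (dec-true (P? x) px))

  ∈⟦⟧⁻ : x ∈ ⟦ P? ⟧ → P x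
  ∈⟦⟧⁻ x∈ = does-true (P? x) (trans (sym (lookup∘tabulate (does ∘ P?) x)) ([]=⇒lookup x∈))

module _ (adj : Fin m → Fin n → Bool) where

  HasNeighbourIn : Subset m → Fin n → Set
  HasNeighbourIn T v = ∃ λ u → u ∈ T × adj u v ≡ true

  hasNeighbourIn? : ∀ T v → Dec (HasNeighbourIn T v)
  hasNeighbourIn? T v = any? λ u → u ∈? T ×-dec adj u v ≟ᵇ true

  N : Subset m → Subset n
  N T = ⟦ hasNeighbourIn? T ⟧

  ∈N⁺ : ∀ {T u v} → u ∈ T → adj u v ≡ true → v ∈ N T
  ∈N⁺ {T} u∈T uv = ∈⟦⟧⁺ (hasNeighbourIn? T) (_ , u∈T , uv)

  ∈N⁻ : ∀ {T v} → v ∈ N T → HasNeighbourIn T v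
  ∈N⁻ {T} = ∈⟦⟧⁻ (hasNeighbourIn? T)

  N-mono : ∀ {T T′} → T ⊆ T′ → N T ⊆ N T′
  N-mono T⊆T′ v∈ with ∈N⁻ v∈
  ... | u , u∈T , uv = ∈N⁺ (T⊆T′ u∈T) uv

∣p∪q∣≤∣p∣+∣q∣ : ∀ (p q : Subset n) → ∣ p ∪ q ∣ ≤ ∣ p ∣ + ∣ q ∣
∣p∪q∣≤∣p∣+∣q∣ []            []            = z≤n
∣p∪q∣≤∣p∣+∣q∣ (inside  ∷ p) (s ∷ q)       =
  s≤s (≤-trans (∣p∪q∣≤∣p∣+∣q∣ p q) (+-monoʳ-≤ ∣ p ∣ (∣p∣≤∣x∷p∣ s q)))
∣p∪q∣≤∣p∣+∣q∣ (outside ∷ p) (inside  ∷ q) =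
  ≤-trans (s≤s (∣p∪q∣≤∣p∣+∣q∣ p q)) (≤-reflexive (sym (+-suc ∣ p ∣ ∣ q ∣)))
∣p∪q∣≤∣p∣+∣q∣ (outside ∷ p) (outside ∷ q) = ∣p∪q∣≤∣p∣+∣q∣ p q

∣p∪q∣≡∣p∣+∣q∣ : ∀ (p q : Subset n) → Empty (p ∩ q) → ∣ p ∪ q ∣ ≡ ∣ p ∣ + ∣ q ∣
∣p∪q∣≡∣p∣+∣q∣ []            []            _ = refl
∣p∪q∣≡∣p∣+∣q∣ (inside  ∷ p) (inside  ∷ q) e = contradiction (zero , here) e
∣p∪q∣≡∣p∣+∣q∣ (inside  ∷ p) (outside ∷ q) e = cong suc (∣p∪q∣≡∣p∣+∣q∣ p q (drop-∷-Empty e))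
∣p∪q∣≡∣p∣+∣q∣ (outside ∷ p) (inside  ∷ q) e =
  trans (cong suc (∣p∪q∣≡∣p∣+∣q∣ p q (drop-∷-Empty e))) (sym (+-suc ∣ p ∣ ∣ q ∣))
∣p∪q∣≡∣p∣+∣q∣ (outside ∷ p) (outside ∷ q) e = ∣p∪q∣≡∣p∣+∣q∣ p q (drop-∷-Empty e)

module _ {p q r : Subset n} where

  ∪-least : p ⊆ r → q ⊆ r → p ∪ q ⊆ r
  ∪-least p⊆r q⊆r x∈ = [ p⊆r , q⊆r ]′ (x∈p∪q⁻ p q x∈)

  disjoint⇒∣p∣+∣q∣≤∣r∣ : Empty (p ∩ q) → p ⊆ r → q ⊆ r → ∣ p ∣ + ∣ q ∣ ≤ ∣ r ∣
  disjoint⇒∣p∣+∣q∣≤∣r∣ e p⊆r q⊆r =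
    ≤-trans (≤-reflexive (sym (∣p∪q∣≡∣p∣+∣q∣ p q e))) (p⊆q⇒∣p∣≤∣q∣ (∪-least p⊆r q⊆r))

p⊆q∪r⇒∣p∣≤∣q∣+∣r∣ : ∀ {p : Subset n} q r → p ⊆ q ∪ r → ∣ p ∣ ≤ ∣ q ∣ + ∣ r ∣
p⊆q∪r⇒∣p∣≤∣q∣+∣r∣ q r p⊆ = ≤-trans (p⊆q⇒∣p∣≤∣q∣ p⊆) (∣p∪q∣≤∣p∣+∣q∣ q r)

x∈p─q⇒x∉q : ∀ {p q : Subset n} {x} → x ∈ p ─ q → x ∉ q
x∈p─q⇒x∉q {p = _ ∷ _} {outside ∷ _} here       ()
x∈p─q⇒x∉q {p = _ ∷ _} {_       ∷ _} (there x∈) (there x∈q) = x∈p─q⇒x∉q x∈ x∈q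

p⊆q∪p─q : ∀ (p q : Subset n) → p ⊆ q ∪ (p ─ q)
p⊆q∪p─q p q {x} x∈p with x ∈? q
... | yes x∈q = x∈p∪q⁺ (inj₁ x∈q)
... | no  x∉q = x∈p∪q⁺ (inj₂ (x∈p∧x∉q⇒x∈p─q x∈p x∉q))

∉⇒Empty-∩ : ∀ {p q : Subset n} → (∀ {x} → x ∈ p → x ∉ q) → Empty (p ∩ q)
∉⇒Empty-∩ {p = p} {q} apart (x , x∈) with x∈p∩q⁻ p q x∈
... | x∈p , x∈q = apart x∈p x∈q

⊆⇒Empty-∩─ : ∀ {p q q′ : Subset n} → q′ ⊆ q → Empty (q′ ∩ (p ─ q))
⊆⇒Empty-∩─ q′⊆q = ∉⇒Empty-∩ λ x∈q′ x∈p─q → x∈p─q⇒x∉q x∈p─q (q′⊆q x∈q′)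

x∈p⇒⁅x⁆⊆p : ∀ {p : Subset n} {x} → x ∈ p → ⁅ x ⁆ ⊆ p
x∈p⇒⁅x⁆⊆p {x = x} x∈p y∈ = subst (_∈ _) (sym (x∈⁅y⁆⇒x≡y x y∈)) x∈p

Empty⇒∣p∣≡0 : ∀ {p : Subset n} → Empty p → ∣ p ∣ ≡ 0
Empty⇒∣p∣≡0 {n} e = trans (cong ∣_∣ (Empty-unique e)) (∣⊥∣≡0 n)

0<∣p∣⇒Nonempty : ∀ {p : Subset n} → 0 < ∣ p ∣ → Nonempty p
0<∣p∣⇒Nonempty {p = p} 0<∣p∣ with nonempty? p
... | yes ne = ne
... | no  e  = contradiction (Empty⇒∣p∣≡0 e) (>⇒≢ 0<∣p∣)

-- Hall's theorem

module _ (adj : Fin m → Fin n → Bool) where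

  record Matching (L : Subset m) (R : Subset n) : Set where
    field
      mate           : ∀ {i} → i ∈ L → Fin n
      mate-∈         : ∀ {i} (i∈L : i ∈ L) → mate i∈L ∈ R
      mate-adj       : ∀ {i} (i∈L : i ∈ L) → adj i (mate i∈L) ≡ true
      mate-injective : ∀ {i j} (i∈L : i ∈ L) (j∈L : j ∈ L) → mate i∈L ≡ mate j∈L → i ≡ j

  open Matching

  HallCondition : Subset m → Subset n → Set
  HallCondition L R = ∀ T → T ⊆ L → ∣ T ∣ ≤ ∣ R ∩ N adj T ∣

  matching-mono : ∀ {L L′ R R′} → L′ ⊆ L → R ⊆ R′ → Matching L R → Matching L′ R′
  matching-mono L′⊆L R⊆R′ M = record
    { mate           = mate M ∘ L′⊆L
    ; mate-∈         = R⊆R′ ∘ mate-∈ M ∘ L′⊆L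
    ; mate-adj       = mate-adj M ∘ L′⊆L
    ; mate-injective = λ i∈ j∈ → mate-injective M (L′⊆L i∈) (L′⊆L j∈)
    }

  matching-Empty : ∀ {L R} → Empty L → Matching L R
  matching-Empty e = record
    { mate           = λ i∈ → contradiction (_ , i∈) e
    ; mate-∈         = λ i∈ → contradiction (_ , i∈) e
    ; mate-adj       = λ i∈ → contradiction (_ , i∈) e
    ; mate-injective = λ i∈ → contradiction (_ , i∈) e
    }

  matching-⁅⁆ : ∀ {i j} → adj i j ≡ true → Matching ⁅ i ⁆ ⁅ j ⁆
  matching-⁅⁆ {i} {j} ij = record
    { mate           = λ _ → j
    ; mate-∈         = λ _ → x∈⁅x⁆ j
    ; mate-adj       = λ k∈ → subst (λ k → adj k j ≡ true) (sym (x∈⁅y⁆⇒x≡y i k∈)) ij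
    ; mate-injective = λ k∈ l∈ _ → trans (x∈⁅y⁆⇒x≡y i k∈) (sym (x∈⁅y⁆⇒x≡y i l∈))
    }

  matching-∪ : ∀ {L₁ L₂ R₁ R₂} → Empty (R₁ ∩ R₂) →
               Matching L₁ R₁ → Matching L₂ R₂ → Matching (L₁ ∪ L₂) (R₁ ∪ R₂)
  matching-∪ {L₁} {L₂} {R₁} {R₂} disjoint M₁ M₂ = record
    { mate = mate′ ; mate-∈ = mate′-∈ ; mate-adj = mate′-adj ; mate-injective = mate′-injective }
    where
    ∈L₂ : ∀ {i} → i ∈ L₁ ∪ L₂ → i ∉ L₁ → i ∈ L₂
    ∈L₂ {i} i∈ i∉L₁ = [ (λ i∈L₁ → contradiction i∈L₁ i∉L₁) , (λ i∈L₂ → i∈L₂) ]′ (x∈p∪q⁻ L₁ L₂ i∈)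

    mate′ : ∀ {i} → i ∈ L₁ ∪ L₂ → Fin n
    mate′ {i} i∈ with i ∈? L₁
    ... | yes i∈L₁ = mate M₁ i∈L₁
    ... | no  i∉L₁ = mate M₂ (∈L₂ i∈ i∉L₁)

    mate′-∈ : ∀ {i} (i∈ : i ∈ L₁ ∪ L₂) → mate′ i∈ ∈ R₁ ∪ R₂
    mate′-∈ {i} i∈ with i ∈? L₁
    ... | yes i∈L₁ = x∈p∪q⁺ (inj₁ (mate-∈ M₁ i∈L₁))
    ... | no  i∉L₁ = x∈p∪q⁺ (inj₂ (mate-∈ M₂ (∈L₂ i∈ i∉L₁)))

    mate′-adj : ∀ {i} (i∈ : i ∈ L₁ ∪ L₂) → adj i (mate′ i∈) ≡ true
    mate′-adj {i} i∈ with i ∈? L₁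
    ... | yes i∈L₁ = mate-adj M₁ i∈L₁
    ... | no  i∉L₁ = mate-adj M₂ (∈L₂ i∈ i∉L₁)

    apart : ∀ {i j} (i∈L₁ : i ∈ L₁) (j∈L₂ : j ∈ L₂) → mate M₁ i∈L₁ ≢ mate M₂ j∈L₂
    apart i∈L₁ j∈L₂ eq =
      disjoint (_ , x∈p∩q⁺ (mate-∈ M₁ i∈L₁ , subst (_∈ R₂) (sym eq) (mate-∈ M₂ j∈L₂)))

    mate′-injective : ∀ {i j} (i∈ : i ∈ L₁ ∪ L₂) (j∈ : j ∈ L₁ ∪ L₂) → mate′ i∈ ≡ mate′ j∈ → i ≡ j
    mate′-injective {i} {j} i∈ j∈ eq with i ∈? L₁ | j ∈? L₁
    ... | yes i∈L₁ | yes j∈L₁ = mate-injective M₁ i∈L₁ j∈L₁ eq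
    ... | yes i∈L₁ | no  j∉L₁ = contradiction eq (apart i∈L₁ (∈L₂ j∈ j∉L₁))
    ... | no  i∉L₁ | yes j∈L₁ = contradiction (sym eq) (apart j∈L₁ (∈L₂ i∈ i∉L₁))
    ... | no  i∉L₁ | no  j∉L₁ = mate-injective M₂ (∈L₂ i∈ i∉L₁) (∈L₂ j∈ j∉L₁) eq

  Critical : Subset m → Subset n → Subset m → Set
  Critical L R S = S ⊆ L × Nonempty S × ∣ S ∣ < ∣ L ∣ × ∣ R ∩ N adj S ∣ ≤ ∣ S ∣

  critical? : ∀ L R S → Dec (Critical L R S)
  critical? L R S =
    S ⊆? L ×-dec nonempty? S ×-dec ∣ S ∣ <? ∣ L ∣ ×-dec ∣ R ∩ N adj S ∣ ≤? ∣ S ∣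

  HallCondition-inside : ∀ {L R S} → S ⊆ L → HallCondition L R → HallCondition S (R ∩ N adj S)
  HallCondition-inside {R = R} {S} S⊆L hallLR T T⊆S =
    ≤-trans (hallLR T (S⊆L ∘ T⊆S)) (p⊆q⇒∣p∣≤∣q∣ narrow)
    where
    narrow : R ∩ N adj T ⊆ (R ∩ N adj S) ∩ N adj T
    narrow v∈ with x∈p∩q⁻ R _ v∈
    ... | v∈R , v∈NT = x∈p∩q⁺ (x∈p∩q⁺ (v∈R , N-mono adj T⊆S v∈NT) , v∈NT)

  HallCondition-outside : ∀ {L R S} → S ⊆ L → ∣ R ∩ N adj S ∣ ≤ ∣ S ∣ →
                 HallCondition L R → HallCondition (L ─ S) (R ─ N adj S)
  HallCondition-outside {L} {R} {S} S⊆L tight hallLR T T⊆L─S = +-cancelˡ-≤ ∣ S ∣ ∣ T ∣ _ (begin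
    ∣ S ∣ + ∣ T ∣                                  ≡⟨ ∣p∪q∣≡∣p∣+∣q∣ S T disjoint ⟨
    ∣ S ∪ T ∣                                      ≤⟨ hallLR (S ∪ T) (∪-least S⊆L (p─q⊆p L S ∘ T⊆L─S)) ⟩
    ∣ R ∩ N adj (S ∪ T) ∣                          ≤⟨ p⊆q∪r⇒∣p∣≤∣q∣+∣r∣ _ _ split ⟩
    ∣ R ∩ N adj S ∣ + ∣ (R ─ N adj S) ∩ N adj T ∣  ≤⟨ +-monoˡ-≤ _ tight ⟩
    ∣ S ∣ + ∣ (R ─ N adj S) ∩ N adj T ∣            ∎)
    where
    open ≤-Reasoning
    disjoint : Empty (S ∩ T)
    disjoint = ∉⇒Empty-∩ λ x∈S x∈T → x∈p─q⇒x∉q (T⊆L─S x∈T) x∈S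
    split : R ∩ N adj (S ∪ T) ⊆ (R ∩ N adj S) ∪ ((R ─ N adj S) ∩ N adj T)
    split {v} v∈ with x∈p∩q⁻ R _ v∈ | v ∈? N adj S
    ... | v∈R , _   | yes v∈NS = x∈p∪q⁺ (inj₁ (x∈p∩q⁺ (v∈R , v∈NS)))
    ... | v∈R , v∈N | no  v∉NS with ∈N⁻ adj v∈N
    ... | u , u∈S∪T , uv with x∈p∪q⁻ S T u∈S∪T
    ... | inj₁ u∈S = contradiction (∈N⁺ adj u∈S uv) v∉NS
    ... | inj₂ u∈T = x∈p∪q⁺ (inj₂ (x∈p∩q⁺ (x∈p∧x∉q⇒x∈p─q v∈R v∉NS , ∈N⁺ adj u∈T uv)))

  -- Without critical sets every nonempty T ⊊ L has more than ∣ T ∣ neighbours in R, so deleting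
  -- a single j from R keeps Hall's condition.
  HallCondition-remove : ∀ {L R i j} → i ∈ L → (∀ S → ¬ Critical L R S) →
                HallCondition L R → HallCondition (L - i) (R - j)
  HallCondition-remove {L} {R} {i} {j} i∈L noncritical hallLR T T⊆L-i with nonempty? T
  ... | no  empty    = ≤-trans (≤-reflexive (Empty⇒∣p∣≡0 empty)) z≤n
  ... | yes nonempty = ≤-pred (begin
    suc ∣ T ∣                  ≤⟨ ≰⇒> (λ le → noncritical T (T⊆L , nonempty , ∣T∣<∣L∣ , le)) ⟩
    ∣ R ∩ N adj T ∣            ≤⟨ p⊆q∪r⇒∣p∣≤∣q∣+∣r∣ _ _ split ⟩
    ∣ (R - j) ∩ N adj T ∣ + ∣ ⁅ j ⁆ ∣  ≡⟨ cong (∣ (R - j) ∩ N adj T ∣ +_) (∣⁅x⁆∣≡1 j) ⟩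
    ∣ (R - j) ∩ N adj T ∣ + 1  ≡⟨ +-comm _ 1 ⟩
    suc ∣ (R - j) ∩ N adj T ∣  ∎)
    where
    open ≤-Reasoning
    T⊆L : T ⊆ L
    T⊆L = p─q⊆p L ⁅ i ⁆ ∘ T⊆L-i
    ∣T∣<∣L∣ : ∣ T ∣ < ∣ L ∣
    ∣T∣<∣L∣ = p⊂q⇒∣p∣<∣q∣ (T⊆L , i , i∈L , λ i∈T → x∈p─q⇒x∉q (T⊆L-i i∈T) (x∈⁅x⁆ i))
    split : R ∩ N adj T ⊆ ((R - j) ∩ N adj T) ∪ ⁅ j ⁆
    split {v} v∈ with x∈p∩q⁻ R _ v∈ | v ≟ᶠ j
    ... | _          | yes refl = x∈p∪q⁺ (inj₂ (x∈⁅x⁆ v))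
    ... | v∈R , v∈NT | no  v≢j  = x∈p∪q⁺ (inj₁ (x∈p∩q⁺ (x∈p∧x≢y⇒x∈p-y v∈R v≢j , v∈NT)))

  hall-partner : ∀ {L R i} → i ∈ L → HallCondition L R → ∃ λ j → j ∈ R × adj i j ≡ true
  hall-partner {L} {R} {i} i∈L hallLR
    with 0<∣p∣⇒Nonempty (≤-trans (≤-reflexive (sym (∣⁅x⁆∣≡1 i))) (hallLR ⁅ i ⁆ (x∈p⇒⁅x⁆⊆p i∈L)))
  ... | j , j∈ with x∈p∩q⁻ R _ j∈
  ... | j∈R , j∈N with ∈N⁻ adj j∈N
  ... | k , k∈⁅i⁆ , kj = j , j∈R , subst (λ k → adj k j ≡ true) (x∈⁅y⁆⇒x≡y i k∈⁅i⁆) kj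

  HasMatching : Subset m → Set
  HasMatching L = ∀ R → HallCondition L R → Matching L R

  -- Induction on ∣ L ∣: split L along a critical set if there is one, otherwise match any i ∈ L
  -- to any neighbour j ∈ R and recurse on L - i, R - j.
  hall : ∀ L → HasMatching L
  hall = WF.All.wfRec (On.wellFounded ∣_∣ <-wellFounded) 0ℓ HasMatching step
    where
    step : ∀ L → WF.WfRec (_<_ on ∣_∣) HasMatching L → HasMatching L
    step L rec R hallLR with nonempty? L
    ... | no  empty     = matching-Empty empty
    ... | yes (i , i∈L) with anySubset? (critical? L R)
    ... | yes (S , S⊆L , (k , k∈S) , ∣S∣<∣L∣ , tight) =
      matching-mono (p⊆q∪p─q L S) (∪-least (p∩q⊆p R (N adj S)) (p─q⊆p R (N adj S)))
        (matching-∪ (⊆⇒Empty-∩─ {p = R} (p∩q⊆q R (N adj S)))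
          (rec ∣S∣<∣L∣ (R ∩ N adj S) (HallCondition-inside {L} {R} S⊆L hallLR))
          (rec (p∩q≢∅⇒∣p─q∣<∣p∣ L S (k , x∈p∩q⁺ (S⊆L k∈S , k∈S))) (R ─ N adj S)
               (HallCondition-outside {L} {R} S⊆L tight hallLR)))
    ... | no noncritical with hall-partner i∈L hallLR
    ... | j , j∈R , ij =
      matching-mono (p⊆q∪p─q L ⁅ i ⁆) (∪-least (x∈p⇒⁅x⁆⊆p j∈R) (p─q⊆p R ⁅ j ⁆))
        (matching-∪ (⊆⇒Empty-∩─ {p = R} ⊆-refl) (matching-⁅⁆ ij)
          (rec (x∈p⇒∣p-x∣<∣p∣ i∈L) (R - j)
               (HallCondition-remove {L} {R} {j = j} i∈L (λ S c → noncritical (S , c)) hallLR)))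

-- Kőnig's theorem

m+n≤o⇒p≤q+r⇒o+q≤m+p⇒n≤r : ∀ {m n o p q r} → m + n ≤ o → p ≤ q + r → o + q ≤ m + p → n ≤ r
m+n≤o⇒p≤q+r⇒o+q≤m+p⇒n≤r {m} {n} {o} {p} {q} {r} m+n≤o p≤q+r o+q≤m+p =
  +-cancelˡ-≤ (m + p) n r (begin
    m + p + n    ≡⟨ +-assoc m p n ⟩
    m + (p + n)  ≡⟨ cong (m +_) (+-comm p n) ⟩
    m + (n + p)  ≡⟨ +-assoc m n p ⟨
    m + n + p    ≤⟨ +-mono-≤ m+n≤o p≤q+r ⟩
    o + (q + r)  ≡⟨ +-assoc o q r ⟨
    o + q + r    ≤⟨ +-monoˡ-≤ r o+q≤m+p ⟩
    m + p + r    ∎)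
  where open ≤-Reasoning

argmax : (f : Subset n → ℕ) → ∃ λ p → ∀ q → f q ≤ f p
argmax {zero}  f = [] , λ { [] → ≤-refl }
argmax {suc n} f with argmax (f ∘ (inside ∷_)) | argmax (f ∘ (outside ∷_))
... | p , p-max | p′ , p′-max with ≤-total (f (inside ∷ p)) (f (outside ∷ p′))
... | inj₁ ≤p′ = outside ∷ p′ , λ { (inside ∷ q) → ≤-trans (p-max q) ≤p′ ; (outside ∷ q) → p′-max q }
... | inj₂ ≤p  = inside ∷ p , λ { (inside ∷ q) → p-max q ; (outside ∷ q) → ≤-trans (p′-max q) ≤p }

enumerate : (p : Subset n) → Fin ∣ p ∣ → Fin n
enumerate (inside  ∷ p) zero    = zero
enumerate (inside  ∷ p) (suc k) = suc (enumerate p k)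
enumerate (outside ∷ p) k       = suc (enumerate p k)

enumerate-∈ : ∀ (p : Subset n) k → enumerate p k ∈ p
enumerate-∈ (inside  ∷ p) zero    = here
enumerate-∈ (inside  ∷ p) (suc k) = there (enumerate-∈ p k)
enumerate-∈ (outside ∷ p) k       = there (enumerate-∈ p k)

enumerate-injective : ∀ (p : Subset n) → Injective _≡_ _≡_ (enumerate p)
enumerate-injective (inside  ∷ p) {zero}  {zero}  _  = refl
enumerate-injective (inside  ∷ p) {suc k} {suc l} eq =
  cong suc (enumerate-injective p (suc-injective eq))
enumerate-injective (outside ∷ p)                 eq = enumerate-injective p (suc-injective eq)

++-injective : ∀ {A : Set} {k l} {f : Fin k → A} {g : Fin l → A} →
               Injective _≡_ _≡_ f → Injective _≡_ _≡_ g → (∀ i j → f i ≢ g j) →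
               Injective _≡_ _≡_ (f Vector.++ g)
++-injective {k = k} {l} {f} {g} f-inj g-inj apart {i} {j} eq =
  trans (sym (join-splitAt k l i)) (trans (cong (join k l) (on-sides (splitAt k i) (splitAt k j) eq))
                                          (join-splitAt k l j))
  where
  on-sides : ∀ x y → [ f , g ]′ x ≡ [ f , g ]′ y → x ≡ y
  on-sides (inj₁ x) (inj₁ y) eq = cong inj₁ (f-inj eq)
  on-sides (inj₁ x) (inj₂ y) eq = contradiction eq (apart x y)
  on-sides (inj₂ x) (inj₁ y) eq = contradiction (sym eq) (apart y x)
  on-sides (inj₂ x) (inj₂ y) eq = cong inj₂ (g-inj eq)

matchings⇒IndepArcs : ∀ (D : Digraph n) {A B L R} →
  Matching D A R → Matching (flip D) B L → Empty (A ∩ L) → Empty (R ∩ B) →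
  IndepArcs D (∣ A ∣ + ∣ B ∣)
matchings⇒IndepArcs D {A} {B} {L} {R} M₁ M₂ A∩L R∩B = tails , heads , arcs , tails-inj , heads-inj
  where
  open Matching
  tails heads : Fin (∣ A ∣ + ∣ B ∣) → Fin _
  tails = enumerate A Vector.++ (mate M₂ ∘ enumerate-∈ B)
  heads = (mate M₁ ∘ enumerate-∈ A) Vector.++ enumerate B
  arcs : ∀ k → Arc D (tails k) (heads k)
  arcs k with splitAt ∣ A ∣ k
  ... | inj₁ a = mate-adj M₁ (enumerate-∈ A a)
  ... | inj₂ b = mate-adj M₂ (enumerate-∈ B b)
  tails-inj : Injective _≡_ _≡_ tails
  tails-inj = ++-injective (enumerate-injective A)
    (λ eq → enumerate-injective B (mate-injective M₂ _ _ eq))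
    (λ a b eq → A∩L (_ , x∈p∩q⁺ (enumerate-∈ A a , subst (_∈ L) (sym eq) (mate-∈ M₂ _))))
  heads-inj : Injective _≡_ _≡_ heads
  heads-inj = ++-injective
    (λ eq → enumerate-injective A (mate-injective M₁ _ _ eq))
    (enumerate-injective B)
    (λ a b eq → R∩B (_ , x∈p∩q⁺ (mate-∈ M₁ _ , subst (_∈ B) (sym eq) (enumerate-∈ B b))))

-- A vertex cover of the bipartite graph with a left and a right copy of Fin n and an edge u — v
-- for each arc (u, v).
Cover : Digraph n → Subset n → Subset n → Set
Cover D A B = ∀ {u v} → Arc D u v → u ∈ A ⊎ v ∈ B

-- S maximises the surplus ∣ S ∣ − ∣ N S ∣ (kept free of subtraction as ∣ S ∣ + ∣ ∁ (N S) ∣). Its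
-- maximality gives Hall's condition for ∁ S into ∁ (N S), and, reversing the arcs, for N S into S.
kőnig : (D : Digraph n) → ∃₂ λ A B → IndepArcs D (∣ A ∣ + ∣ B ∣) × Cover D A B
kőnig D = ∁ S , N D S ,
          matchings⇒IndepArcs D (hall D (∁ S) (∁ (N D S)) hall₁) (hall (flip D) (N D S) S hall₂)
            (∉⇒Empty-∩ x∈∁p⇒x∉p) (∉⇒Empty-∩ x∈∁p⇒x∉p) ,
          cover
  where
  surplus : Subset _ → ℕ
  surplus S = ∣ S ∣ + ∣ ∁ (N D S) ∣
  S : Subset _
  S = proj₁ (argmax surplus)
  S-max : ∀ S′ → surplus S′ ≤ surplus S
  S-max = proj₂ (argmax surplus)

  hall₁ : HallCondition D (∁ S) (∁ (N D S))
  hall₁ T T⊆∁S = m+n≤o⇒p≤q+r⇒o+q≤m+p⇒n≤r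
    (≤-reflexive (sym (∣p∪q∣≡∣p∣+∣q∣ S T S∩T)))
    (p⊆q∪r⇒∣p∣≤∣q∣+∣r∣ (∁ (N D (S ∪ T))) (∁ (N D S) ∩ N D T) split)
    (S-max (S ∪ T))
    where
    S∩T : Empty (S ∩ T)
    S∩T = ∉⇒Empty-∩ λ x∈S x∈T → x∈∁p⇒x∉p (T⊆∁S x∈T) x∈S
    split : ∁ (N D S) ⊆ ∁ (N D (S ∪ T)) ∪ (∁ (N D S) ∩ N D T)
    split {v} v∈∁NS with v ∈? N D (S ∪ T)
    ... | no  v∉ = x∈p∪q⁺ (inj₁ (x∉p⇒x∈∁p v∉))
    ... | yes v∈ with ∈N⁻ D v∈
    ... | u , u∈S∪T , uv with x∈p∪q⁻ S T u∈S∪T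
    ... | inj₁ u∈S = contradiction (∈N⁺ D u∈S uv) (x∈∁p⇒x∉p v∈∁NS)
    ... | inj₂ u∈T = x∈p∪q⁺ (inj₂ (x∈p∩q⁺ (v∈∁NS , ∈N⁺ D u∈T uv)))

  hall₂ : HallCondition (flip D) (N D S) S
  hall₂ T T⊆NS = m+n≤o⇒p≤q+r⇒o+q≤m+p⇒n≤r
    (disjoint⇒∣p∣+∣q∣≤∣r∣ (∉⇒Empty-∩ λ x∈∁NS x∈T → x∈∁p⇒x∉p x∈∁NS (T⊆NS x∈T))
                           (p⊆q⇒∁p⊇∁q (N-mono D (p─q⊆p S _))) T⊆∁NS′)
    (p⊆q∪r⇒∣p∣≤∣q∣+∣r∣ S′ (S ∩ N (flip D) T) split)
    (subst₂ _≤_ (+-comm ∣ S′ ∣ _) (+-comm ∣ S ∣ _) (S-max S′))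
    where
    S′ : Subset _
    S′ = S ─ N (flip D) T
    T⊆∁NS′ : T ⊆ ∁ (N D S′)
    T⊆∁NS′ v∈T = x∉p⇒x∈∁p λ v∈NS′ →
      let u , u∈S′ , uv = ∈N⁻ D v∈NS′ in x∈p─q⇒x∉q u∈S′ (∈N⁺ (flip D) v∈T uv)
    split : S ⊆ S′ ∪ (S ∩ N (flip D) T)
    split {u} u∈S with u ∈? N (flip D) T
    ... | yes u∈ = x∈p∪q⁺ (inj₂ (x∈p∩q⁺ (u∈S , u∈)))
    ... | no  u∉ = x∈p∪q⁺ (inj₁ (x∈p∧x∉q⇒x∈p─q u∈S u∉))

  cover : Cover D (∁ S) (N D S)
  cover {u} uv with u ∈? S
  ... | yes u∈S = inj₂ (∈N⁺ D u∈S uv)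
  ... | no  u∉S = inj₁ (x∉p⇒x∈∁p u∉S)

-- Counting images

Unique-⊆⇒length≤ : ∀ {A : Set} {xs ys : List A} → Unique xs → (∀ {z} → z ∈ˡ xs → z ∈ˡ ys) →
                   length xs ≤ length ys
Unique-⊆⇒length≤ {xs = []} _ _ = z≤n
Unique-⊆⇒length≤ {xs = x ∷ xs} (x∉xs ∷ xs!) xs⊆ys with ∈-∃++ (xs⊆ys (hereˡ refl))
... | ys₁ , ys₂ , refl =
  subst (suc (length xs) ≤_) (sym length-around) (s≤s (Unique-⊆⇒length≤ xs! xs⊆ys₁++ys₂))
  where
  length-around : length (ys₁ ++ˡ x ∷ ys₂) ≡ suc (length (ys₁ ++ˡ ys₂))
  length-around =
    trans (length-++ ys₁) (trans (+-suc (length ys₁) (length ys₂)) (cong suc (sym (length-++ ys₁))))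
  xs⊆ys₁++ys₂ : ∀ {z} → z ∈ˡ xs → z ∈ˡ ys₁ ++ˡ ys₂
  xs⊆ys₁++ys₂ z∈xs with ∈-++⁻ ys₁ (xs⊆ys (thereˡ z∈xs))
  ... | inj₁ z∈ys₁         = ∈-++⁺ˡ z∈ys₁
  ... | inj₂ (hereˡ refl)   = contradiction refl (All.lookup x∉xs z∈xs)
  ... | inj₂ (thereˡ z∈ys₂) = ∈-++⁺ʳ ys₁ z∈ys₂

module _ {A B C : Set} (f : A → B → C) (ys : List B) where

  concatMap≡cartesianProductWith : ∀ xs →
    concatMap (λ x → map (f x) ys) xs ≡ cartesianProductWith f xs ys
  concatMap≡cartesianProductWith []       = refl
  concatMap≡cartesianProductWith (x ∷ xs) = cong (map (f x) ys ++ˡ_) (concatMap≡cartesianProductWith xs)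

  length-cartesianProductWith : ∀ xs → length (cartesianProductWith f xs ys) ≡ length xs * length ys
  length-cartesianProductWith []       = refl
  length-cartesianProductWith (x ∷ xs) =
    trans (length-++ (map (f x) ys)) (cong₂ _+_ (length-map (f x) ys) (length-cartesianProductWith xs))

allConfigs-suc : ∀ q n → allConfigs q (suc n) ≡ cartesianProductWith _∷_ (allFin q) (allConfigs q n)
allConfigs-suc q n = concatMap≡cartesianProductWith _∷_ (allConfigs q n) (allFin q)

∈-allConfigs : ∀ {q n} (x : Config q n) → x ∈ˡ allConfigs q n
∈-allConfigs             []       = hereˡ refl
∈-allConfigs {q} {suc n} (a ∷ x) =
  subst (_ ∈ˡ_) (sym (allConfigs-suc q n)) (∈-cartesianProductWith⁺ _∷_ (∈-allFin a) (∈-allConfigs x))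

allConfigs-! : ∀ q n → Unique (allConfigs q n)
allConfigs-! q zero    = All.[] ∷ []
allConfigs-! q (suc n) =
  subst Unique (sym (allConfigs-suc q n))
    (cartesianProductWith⁺ _∷_ ∷-injective (allFin⁺ q) (allConfigs-! q n))

length-allConfigs : ∀ q n → length (allConfigs q n) ≡ q ^ n
length-allConfigs q zero    = refl
length-allConfigs q (suc n) = begin
  length (allConfigs q (suc n))
    ≡⟨ cong length (allConfigs-suc q n) ⟩
  length (cartesianProductWith _∷_ (allFin q) (allConfigs q n))
    ≡⟨ length-cartesianProductWith _∷_ _ (allFin q) ⟩
  length (allFin q) * length (allConfigs q n)
    ≡⟨ cong₂ _*_ (length-tabulate {n = q} id) (length-allConfigs q n) ⟩
  q * q ^ n ∎
  where open ≡-Reasoning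

factorisation⇒imSize≤ : ∀ {q n m} (f : Map q n)
  (encode : Config q n → Vec (Fin q) m) (decode : Vec (Fin q) m → Config q n) →
  (∀ x → decode (encode x) ≡ f x) → imSize f ≤ q ^ m
factorisation⇒imSize≤ {q} {n} {m} f encode decode decode∘encode =
  subst (imSize f ≤_) (trans (length-map decode (allConfigs q m)) (length-allConfigs q m))
    (Unique-⊆⇒length≤ (deduplicate-! (≡-dec _≟ᶠ_) (map f (allConfigs q n))) image⊆)
  where
  image⊆ : ∀ {y} → y ∈ˡ deduplicate (≡-dec _≟ᶠ_) (map f (allConfigs q n)) →
                   y ∈ˡ map decode (allConfigs q m)
  image⊆ y∈ with ∈-map⁻ f (∈-deduplicate⁻ (≡-dec _≟ᶠ_) (map f (allConfigs q n)) y∈)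
  ... | x , _ , refl = subst (_∈ˡ _) (decode∘encode x) (∈-map⁺ decode (∈-allConfigs (encode x)))

retraction⇒imSize≥ : ∀ {q n m} (f : Map q n)
  (embed : Vec (Fin q) m → Config q n) (decode : Config q n → Vec (Fin q) m) →
  (∀ c → decode (f (embed c)) ≡ c) → q ^ m ≤ imSize f
retraction⇒imSize≥ {q} {n} {m} f embed decode decode∘f∘embed =
  subst (_≤ imSize f) (trans (length-map (λ c → f (embed c)) (allConfigs q m)) (length-allConfigs q m))
    (Unique-⊆⇒length≤ (map⁺ f∘embed-injective (allConfigs-! q m)) image⊆)
  where
  f∘embed-injective : ∀ {c c′} → f (embed c) ≡ f (embed c′) → c ≡ c′
  f∘embed-injective {c} {c′} eq =
    trans (sym (decode∘f∘embed c)) (trans (cong decode eq) (decode∘f∘embed c′))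
  image⊆ : ∀ {y} → y ∈ˡ map (λ c → f (embed c)) (allConfigs q m) →
                   y ∈ˡ deduplicate (≡-dec _≟ᶠ_) (map f (allConfigs q n))
  image⊆ y∈ with ∈-map⁻ (λ c → f (embed c)) y∈
  ... | c , _ , refl = ∈-deduplicate⁺ (≡-dec _≟ᶠ_) (∈-map⁺ f (∈-allConfigs (embed c)))

-- The upper bound

lookup-extensionality : ∀ {A : Set} {xs ys : Vec A n} → (∀ i → lookup xs i ≡ lookup ys i) → xs ≡ ys
lookup-extensionality {xs = xs} {ys} eq =
  trans (sym (tabulate∘lookup xs)) (trans (tabulate-cong eq) (tabulate∘lookup ys))

module _ {A B : Set} where

  Essential : (Vec A n → B) → Fin n → Set
  Essential g u = ∃₂ λ x a → g x ≢ g (x [ u ]≔ a)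

  ≡-on-essential : DecidableEquality B → (g : Vec A n → B) {x y : Vec A n} →
                   (∀ u → lookup x u ≡ lookup y u ⊎ ¬ Essential g u) → g x ≡ g y
  ≡-on-essential _≟_ g {[]}     {[]}     _     = refl
  ≡-on-essential _≟_ g {a ∷ x} {b ∷ y} agree =
    trans head-step (≡-on-essential _≟_ (λ z → g (b ∷ z)) tail-agree)
    where
    head-step : g (a ∷ x) ≡ g (b ∷ x)
    head-step with agree zero
    ... | inj₁ a≡b  = cong (λ c → g (c ∷ x)) a≡b
    ... | inj₂ ¬ess with g (a ∷ x) ≟ g (b ∷ x)
    ...   | yes eq  = eq
    ...   | no  neq = contradiction (a ∷ x , b , neq) ¬ess
    tail-agree : ∀ u → lookup x u ≡ lookup y u ⊎ ¬ Essential (λ z → g (b ∷ z)) u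
    tail-agree u with agree (suc u)
    ... | inj₁ eq   = inj₁ eq
    ... | inj₂ ¬ess = inj₂ λ { (z , c , neq) → ¬ess (b ∷ z , c , neq) }

module _ {A : Set} where

  select : (p : Subset n) → Vec A n → Vec A ∣ p ∣
  select []            []       = []
  select (inside  ∷ p) (x ∷ xs) = x ∷ select p xs
  select (outside ∷ p) (x ∷ xs) = select p xs

  merge : (p : Subset n) → Vec A ∣ p ∣ → Vec A n → Vec A n
  merge []            []       []       = []
  merge (inside  ∷ p) (x ∷ xs) (_ ∷ ys) = x ∷ merge p xs ys
  merge (outside ∷ p) xs       (y ∷ ys) = y ∷ merge p xs ys

  lookup-merge-∈ : ∀ (p : Subset n) (xs ys : Vec A n) {i} → i ∈ p →
                   lookup (merge p (select p xs) ys) i ≡ lookup xs i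
  lookup-merge-∈ (inside  ∷ p) (x ∷ xs) (_ ∷ ys) here       = refl
  lookup-merge-∈ (inside  ∷ p) (x ∷ xs) (_ ∷ ys) (there i∈) = lookup-merge-∈ p xs ys i∈
  lookup-merge-∈ (outside ∷ p) (x ∷ xs) (_ ∷ ys) (there i∈) = lookup-merge-∈ p xs ys i∈

  lookup-merge-∉ : ∀ (p : Subset n) xs (ys : Vec A n) {i} → i ∉ p →
                   lookup (merge p xs ys) i ≡ lookup ys i
  lookup-merge-∉ (inside  ∷ p) (x ∷ xs) (y ∷ ys) {zero}  i∉ = contradiction here i∉
  lookup-merge-∉ (outside ∷ p) xs       (y ∷ ys) {zero}  i∉ = refl
  lookup-merge-∉ (inside  ∷ p) (x ∷ xs) (y ∷ ys) {suc i} i∉ = lookup-merge-∉ p xs ys (i∉ ∘ there)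
  lookup-merge-∉ (outside ∷ p) xs       (y ∷ ys) {suc i} i∉ = lookup-merge-∉ p xs ys (i∉ ∘ there)

cover⇒imSize≤ : ∀ {q A B} (D : Digraph n) → Cover D A B → (f : Map (suc q) n) → IGSub f D →
                imSize f ≤ suc q ^ (∣ A ∣ + ∣ B ∣)
cover⇒imSize≤ {n} {q} {A} {B} D cover f f⊆D = factorisation⇒imSize≤ f encode decode decode∘encode
  where
  encode : Config (suc q) n → Vec (Fin (suc q)) (∣ A ∣ + ∣ B ∣)
  encode x = select A x ++ select B (f x)

  decode : Vec (Fin (suc q)) (∣ A ∣ + ∣ B ∣) → Config (suc q) n
  decode y = merge B (drop ∣ A ∣ y) (f (merge A (take ∣ A ∣ y) (replicate n zero)))

  decode∘encode : ∀ x → decode (encode x) ≡ f x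
  decode∘encode x = trans (cong₂ (λ a b → merge B b (f (merge A a (replicate n zero)))) take≡ drop≡)
                          (lookup-extensionality coordinate)
    where
    take++drop : take (∣ A ∣) (encode x) ++ drop (∣ A ∣) (encode x) ≡ encode x
    take++drop = take++drop≡id ∣ A ∣ (encode x)
    take≡ : take ∣ A ∣ (encode x) ≡ select A x
    take≡ = ++-injectiveˡ _ _ take++drop
    drop≡ : drop ∣ A ∣ (encode x) ≡ select B (f x)
    drop≡ = ++-injectiveʳ _ _ take++drop
    x̂ : Config (suc q) n
    x̂ = merge A (select A x) (replicate n zero)
    coordinate : ∀ v → lookup (merge B (select B (f x)) (f x̂)) v ≡ lookup (f x) v
    coordinate v with v ∈? B
    ... | yes v∈B = lookup-merge-∈ B (f x) (f x̂) v∈B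
    ... | no  v∉B =
      trans (lookup-merge-∉ B _ (f x̂) v∉B) (≡-on-essential _≟ᶠ_ (λ z → lookup (f z) v) agree)
      where
      agree : ∀ u → lookup x̂ u ≡ lookup x u ⊎ ¬ Essential (λ z → lookup (f z) v) u
      agree u with u ∈? A
      ... | yes u∈A = inj₁ (lookup-merge-∈ A x _ u∈A)
      ... | no  u∉A = inj₂ λ ess → [ u∉A , v∉B ]′ (cover (f⊆D u v ess))

-- A map attaining the bound

SomeLarge : (Fin n → Set) → (Fin n → Bool) → Set
SomeLarge P large = ∃ λ u → P u × large u ≡ true

someLarge? : ∀ {P : Fin n → Set} → (∀ u → Dec (P u)) → ∀ large → Dec (SomeLarge P large)
someLarge? P? large = any? λ u → P? u ×-dec large u ≟ᵇ true

SomeLarge-transport : ∀ {P : Fin n → Set} {large large′} → (∀ u → P u → large u ≡ large′ u) →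
                      SomeLarge P large → SomeLarge P large′
SomeLarge-transport agree (u , pu , u-large) = u , pu , trans (sym (agree u pu)) u-large

someLarge-cong : ∀ {P : Fin n → Set} (P? : ∀ u → Dec (P u)) {large large′} →
                 (∀ u → P u → large u ≡ large′ u) →
                 does (someLarge? P? large) ≡ does (someLarge? P? large′)
someLarge-cong P? agree =
  does-⇔ (mk⇔ (SomeLarge-transport agree) (SomeLarge-transport λ u pu → sym (agree u pu)))
         (someLarge? P? _) (someLarge? P? _)

module Construction {n a r : ℕ} (D : Digraph n) (s t : Fin a → Fin n)
                    (arcs : ∀ i → Arc D (s i) (t i))
                    (s-injective : Injective _≡_ _≡_ s) (t-injective : Injective _≡_ _≡_ t) where

  q : ℕ
  q = suc (suc r)

  large : Fin q → Bool
  large zero          = false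
  large (suc zero)    = false
  large (suc (suc _)) = true

  swap01 : Fin q → Fin q
  swap01 zero          = suc zero
  swap01 (suc zero)    = zero
  swap01 (suc (suc c)) = suc (suc c)

  swapIf : Bool → Fin q → Fin q
  swapIf b c = if b then swap01 c else c

  large-swapIf : ∀ b c → large (swapIf b c) ≡ large c
  large-swapIf false c             = refl
  large-swapIf true  zero          = refl
  large-swapIf true  (suc zero)    = refl
  large-swapIf true  (suc (suc c)) = refl

  swapIf-involutive : ∀ b c → swapIf b (swapIf b c) ≡ c
  swapIf-involutive false c             = refl
  swapIf-involutive true  zero          = refl
  swapIf-involutive true  (suc zero)    = refl
  swapIf-involutive true  (suc (suc c)) = refl

  indicator : Bool → Fin q
  indicator false = zero
  indicator true  = suc zero

  largeAt : Config q n → Fin n → Bool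
  largeAt x = large ∘ lookup x

  arc? : ∀ v u → Dec (Arc D u v)
  arc? v u = D u v ≟ᵇ true

  otherArc? : ∀ i u → Dec (u ≢ s i × Arc D u (t i))
  otherArc? i u = ¬? (u ≟ᶠ s i) ×-dec arc? (t i) u

  pulled : Fin a → (Fin n → Bool) → Bool
  pulled i = does ∘ someLarge? (otherArc? i)

  lit : Fin n → (Fin n → Bool) → Bool
  lit v = does ∘ someLarge? (arc? v)

  head? : ∀ v → Dec (∃ λ i → t i ≡ v)
  head? v = any? λ i → t i ≟ᶠ v

  tail? : ∀ w → Dec (∃ λ j → s j ≡ w)
  tail? w = any? λ j → s j ≟ᶠ w

  coordinate : ∀ v → Dec (∃ λ i → t i ≡ v) → Config q n → Fin q
  coordinate v (yes (i , _)) x = swapIf (pulled i (largeAt x)) (lookup x (s i))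
  coordinate v (no  _)       x = indicator (lit v (largeAt x))

  F : Map q n
  F x = tabulate λ v → coordinate v (head? v) x

  lookup-F : ∀ x v → lookup (F x) v ≡ coordinate v (head? v) x
  lookup-F x v = lookup∘tabulate (λ v → coordinate v (head? v) x) v

  lookup-F-head : ∀ x i → lookup (F x) (t i) ≡ swapIf (pulled i (largeAt x)) (lookup x (s i))
  lookup-F-head x i = trans (lookup-F x (t i)) (at-head (head? (t i)))
    where
    at-head : ∀ d → coordinate (t i) d x ≡ swapIf (pulled i (largeAt x)) (lookup x (s i))
    at-head (yes (j , tj≡ti)) with t-injective tj≡ti
    ... | refl = refl
    at-head (no ¬head) = contradiction (i , refl) ¬head

  F⊆D : IGSub F D
  F⊆D u v (x , c , differs) with D u v ≟ᵇ true
  ... | yes uv  = uv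
  ... | no  ¬uv =
    contradiction (trans (lookup-F x v) (trans (unchanged (head? v)) (sym (lookup-F x′ v)))) differs
    where
    x′ : Config q n
    x′ = x [ u ]≔ c
    agree : ∀ w → Arc D w v → largeAt x w ≡ largeAt x′ w
    agree w wv = cong large (sym (lookup∘update′ (λ { refl → ¬uv wv }) x c))
    unchanged : ∀ d → coordinate v d x ≡ coordinate v d x′
    unchanged (yes (i , refl)) =
      cong₂ swapIf (someLarge-cong (otherArc? i) λ w (_ , wv) → agree w wv)
                   (sym (lookup∘update′ (λ { refl → ¬uv (arcs i) }) x c))
    unchanged (no _) = cong indicator (someLarge-cong (arc? v) agree)

  embedAt : Vec (Fin q) a → ∀ w → Dec (∃ λ j → s j ≡ w) → Fin q
  embedAt c w (yes (j , _)) = lookup c j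
  embedAt c w (no  _)       = zero

  embed : Vec (Fin q) a → Config q n
  embed c = tabulate λ w → embedAt c w (tail? w)

  lookup-embed : ∀ c w → lookup (embed c) w ≡ embedAt c w (tail? w)
  lookup-embed c w = lookup∘tabulate (λ w → embedAt c w (tail? w)) w

  lookup-embed-tail : ∀ c j → lookup (embed c) (s j) ≡ lookup c j
  lookup-embed-tail c j = trans (lookup-embed c (s j)) (at-tail (tail? (s j)))
    where
    at-tail : ∀ d → embedAt c (s j) d ≡ lookup c j
    at-tail (yes (k , sk≡sj)) with s-injective sk≡sj
    ... | refl = refl
    at-tail (no ¬tail) = contradiction (j , refl) ¬tail

  predictedAt : Config q n → ∀ w → Dec (∃ λ j → s j ≡ w) → Bool
  predictedAt y w (yes (j , _)) = large (lookup y (t j))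
  predictedAt y w (no  _)       = false

  decode : Config q n → Vec (Fin q) a
  decode y = tabulate λ i → swapIf (pulled i (λ w → predictedAt y w (tail? w))) (lookup y (t i))

  predictedAt-F-embed : ∀ c w → predictedAt (F (embed c)) w (tail? w) ≡ largeAt (embed c) w
  predictedAt-F-embed c w with tail? w | lookup-embed c w
  ... | yes (j , refl) | _ =
    trans (cong large (lookup-F-head (embed c) j)) (large-swapIf _ (lookup (embed c) (s j)))
  ... | no  _          | embed≡zero = sym (cong large embed≡zero)

  decode-F-embed : ∀ c → decode (F (embed c)) ≡ c
  decode-F-embed c = lookup-extensionality λ i → begin
    lookup (decode (F x)) i
      ≡⟨ lookup∘tabulate _ i ⟩
    swapIf (pulled i (λ w → predictedAt (F x) w (tail? w))) (lookup (F x) (t i))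
      ≡⟨ cong₂ swapIf (someLarge-cong (otherArc? i) λ w _ → predictedAt-F-embed c w)
                      (lookup-F-head x i) ⟩
    swapIf (pulled i (largeAt x)) (swapIf (pulled i (largeAt x)) (lookup x (s i)))
      ≡⟨ swapIf-involutive (pulled i (largeAt x)) (lookup x (s i)) ⟩
    lookup x (s i)
      ≡⟨ lookup-embed-tail c i ⟩
    lookup c i ∎
    where
    open ≡-Reasoning
    x : Config q n
    x = embed c

  large⇒≢zero : ∀ {c} → large c ≡ true → c ≢ zero
  large⇒≢zero c-large refl = contradiction c-large λ ()

  module _ {c : Fin q} (c-large : large c ≡ true) where

    zeros : Config q n
    zeros = replicate n zero

    someLarge-zeros : ∀ {P : Fin n → Set} (P? : ∀ u → Dec (P u)) →
                      does (someLarge? P? (largeAt zeros)) ≡ false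
    someLarge-zeros P? = dec-false (someLarge? P? _) λ (u , _ , u-large) →
      contradiction (trans (sym (cong large (lookup-replicate u zero))) u-large) λ ()

    lookup-F-zeros : ∀ v → lookup (F zeros) v ≡ zero
    lookup-F-zeros v = trans (lookup-F zeros v) (at (head? v))
      where
      at : ∀ d → coordinate v d zeros ≡ zero
      at (yes (i , _)) =
        trans (cong (λ b → swapIf b (lookup zeros (s i))) (someLarge-zeros (otherArc? i)))
              (lookup-replicate (s i) zero)
      at (no  _)       = cong indicator (someLarge-zeros (arc? v))

    lookup-F-bump : ∀ {u v} → Arc D u v → lookup (F (zeros [ u ]≔ c)) v ≢ zero
    lookup-F-bump {u} {v} uv = subst (_≢ zero) (sym (lookup-F x′ v)) (at (head? v))
      where
      x′ : Config q n
      x′ = zeros [ u ]≔ c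
      u-large : largeAt x′ u ≡ true
      u-large = trans (cong large (lookup∘update u zeros c)) c-large
      at : ∀ d → coordinate v d x′ ≢ zero
      at (yes (i , refl)) with u ≟ᶠ s i
      ... | yes refl = large⇒≢zero (trans (large-swapIf _ (lookup x′ u)) u-large)
      ... | no  u≢si = subst (_≢ zero) (sym (cong₂ swapIf pulled-i x′-si)) λ ()
        where
        pulled-i : pulled i (largeAt x′) ≡ true
        pulled-i = dec-true (someLarge? (otherArc? i) (largeAt x′)) (u , (u≢si , uv) , u-large)
        x′-si : lookup x′ (s i) ≡ zero
        x′-si = trans (lookup∘update′ (u≢si ∘ sym) zeros c) (lookup-replicate (s i) zero)
      at (no _) = subst (_≢ zero) (sym (cong indicator lit-v)) λ ()
        where
        lit-v : lit v (largeAt x′) ≡ true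
        lit-v = dec-true (someLarge? (arc? v) (largeAt x′)) (u , uv , u-large)

    D⊆F : ∀ u v → Arc D u v → DependsOn F u v
    D⊆F u v uv = zeros , c , λ eq → lookup-F-bump uv (trans (sym eq) (lookup-F-zeros v))

module Ima {n a : ℕ} (D : Digraph n) (maximal : ∀ k → IndepArcs D k → k ≤ a) where

  imSize≤q^a : ∀ {r} (f : Map (suc r) n) → IGSub f D → imSize f ≤ suc r ^ a
  imSize≤q^a {r} f f⊆D with kőnig D
  ... | A , B , indep , cover =
    ≤-trans (cover⇒imSize≤ D cover f f⊆D) (^-monoʳ-≤ (suc r) (maximal _ indep))

  module Attained (s t : Fin a → Fin n) (arcs : ∀ i → Arc D (s i) (t i))
                  (s-injective : Injective _≡_ _≡_ s) (t-injective : Injective _≡_ _≡_ t) where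

    private module C (r : ℕ) = Construction {r = r} D s t arcs s-injective t-injective

    imSize-F : ∀ r → imSize (C.F r) ≡ suc (suc r) ^ a
    imSize-F r = ≤-antisym (imSize≤q^a (C.F r) (C.F⊆D r))
                           (retraction⇒imSize≥ (C.F r) (C.embed r) (C.decode r) (C.decode-F-embed r))

    ima≡α₁ : ∀ r → ImaSub D (suc (suc r)) a
    ima≡α₁ r = (C.F r , C.F⊆D r , imSize-F r) , imSize≤q^a

    ima[]≡α₁ : ∀ r → ImaEq D (suc (suc (suc r))) a
    ima[]≡α₁ r =
      (C.F (suc r) , (λ u v → mk⇔ (C.D⊆F (suc r) {c = suc (suc zero)} refl u v) (C.F⊆D (suc r) u v)) ,
       imSize-F (suc r)) ,
      λ f IG≡D → imSize≤q^a f (λ u v → Equivalence.from (IG≡D u v))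

corollary2 : (n : ℕ) (D : Digraph n) (a : ℕ) → IsAlpha1 D a →
    ((q : ℕ) → 3 ≤ q → ImaEq D q a × ImaSub D q a) × ImaSub D 2 a
corollary2 n D a ((s , t , arcs , s-injective , t-injective) , maximal) =
  (λ { (suc (suc (suc r))) (s≤s (s≤s (s≤s _))) → ima[]≡α₁ r , ima≡α₁ (suc r) }) , ima≡α₁ 0
  where open Ima.Attained D maximal s t arcs s-injective t-injective
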